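{- Let $\mathcal{H}$ be a uniform hypergraph and $u\ne v$ two of its vertices. Let $e_1,\dots,e_r$ ($r\ge1$) be pendent edges incident with $u$ and not containing $v$, and $e_{r+1},\dots,e_{r+t}$ ($t\ge1$) pendent edges incident with $v$ and not containing $u$. Put $e_i'=(e_i\setminus\{u\})\cup\{v\}$ for $i\in[r]$ and $e_i'=(e_i\setminus\{v\})\cup\{u\}$ for $i=r+1,\dots,r+t$. If $d_{\mathcal{H}}(v)\ge d_{\mathcal{H}}(u)$ let $\mathcal{H}'=\mathcal{H}-\{e_1,\dots,e_r\}+\{e_1',\dots,e_r'\}$; if $d_{\mathcal{H}}(v)<d_{\mathcal{H}}(u)$ let $\mathcal{H}'=\mathcal{H}-\{e_{r+1},\dots,e_{r+t}\}+\{e_{r+1}',\dots,e_{r+t}'\}$. Then $M(\mathcal{H}')>M(\mathcal{H})$.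
   Context: $d_{\mathcal{H}}(w)$ is the degree of vertex $w$ (number of edges containing it). A core vertex is a vertex of degree one; a pendent edge is an edge $f$ containing $|f|-1$ core vertices. $\mathcal{H}-E'$ deletes the edges in $E'$, and $+$ adds edges. The Zagreb index $M(\mathcal{H})$ is the sum of the squares of the degrees of all vertices of $\mathcal{H}$. -}

module Defs where

open import Data.Nat using (ℕ; _^_; _≟_)
open import Data.Fin using (Fin)
open import Data.Fin.Subset using (Subset; _∪_; _-_; ⁅_⁆; ∣_∣; _∈_)
open import Data.Fin.Subset.Properties using (_∈?_)
open import Data.List using (List; length; filter; map; allFin; _++_)
open import Data.Nat.ListAction using (sum)
open import Data.List.Relation.Unary.All using (All)
open import Relation.Nullary.Decidable using (⌊_⌋)
open import Relation.Binary.PropositionalEquality using (_≡_)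
open import Data.Nat using (_∸_)

Hypergraph : ℕ → Set
Hypergraph n = List (Subset n)

Uniform : ∀ {n} → ℕ → Hypergraph n → Set
Uniform k H = All (λ e → ∣ e ∣ ≡ k) H

deg : ∀ {n} → Hypergraph n → Fin n → ℕ
deg H w = length (filter (λ e → w ∈? e) H)

coreCount : ∀ {n} → Hypergraph n → Subset n → ℕ
coreCount {n} H f =
  length (filter (λ w → w ∈? f) (filter (λ w → deg H w ≟ 1) (allFin n)))

Pendent : ∀ {n} → Hypergraph n → Subset n → Set
Pendent H f = coreCount H f ≡ ∣ f ∣ ∸ 1

Zagreb : ∀ {n} → Hypergraph n → ℕ
Zagreb {n} H = sum (map (λ w → deg H w ^ 2) (allFin n))

move : ∀ {n} → Fin n → Fin n → Subset n → Subset n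
move x y e = (e - x) ∪ ⁅ y ⁆

-- Moving r edges that contain x but not y over to y shifts r units of degree
-- from x to y and leaves every other degree unchanged.  Writing a = d(x) - r and
-- b = d(y), the Zagreb index grows by a² + (r + b)² - (r + a)² - b² = 2r(b - a),
-- which is positive as soon as d(x) ≤ d(y), i.e. r + a ≤ b.
module Submission where

open import Defs
open import Data.Nat using (ℕ; _≤_; _<_)
open import Data.Fin using (Fin)
open import Data.Fin.Subset using (Subset; _∈_; _∉_)
open import Data.List using (List; length; map; _++_)
open import Data.List.Relation.Unary.All using (All)
open import Data.List.Relation.Unary.Unique.Propositional using (Unique)
open import Data.Product using (_×_)
open import Relation.Binary.PropositionalEquality using (_≢_)

open import Data.Nat using (zero; suc; _+_; _*_; _^_; z≤n; s≤s)
open import Data.Nat.Properties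
  using (+-comm; +-assoc; +-monoʳ-<; +-cancelʳ-<; m<m+n; m≤n⇒∃[o]m+o≡n; <⇒≤)
open import Data.Nat.Tactic.RingSolver using (solve-∀)
open import Data.Nat.ListAction using (sum)
open import Data.Fin using (zero; suc) renaming (_≟_ to _≟ᶠ_)
open import Data.Fin.Properties using (suc-injective)
open import Data.Fin.Subset using (_─_; _-_; ⁅_⁆; inside)
open import Data.Fin.Subset.Properties
  using (_∈?_; x∈⁅x⁆; x∈⁅y⁆⇒x≡y; x∈p∪q⁻; p⊆p∪q; q⊆p∪q; p─q⊆p; x∈p∧x≢y⇒x∈p-y)
open import Data.Vec using (_∷_; here; there)
open import Data.Vec.Functional using (updateAt)
open import Data.Vec.Functional.Properties using (updateAt-updates; updateAt-minimal)
open import Data.List using ([]; _∷_; filter; tabulate)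
open import Data.List.Properties
  using (filter-++; length-++; length-map; filter-all; filter-none;
         filter-accept; filter-reject; tabulate-cong; map-tabulate)
import Data.List.Relation.Unary.All as All
open import Data.List.Relation.Unary.All.Properties using (map⁺)
open import Data.Product using (_,_; proj₁; proj₂)
open import Data.Sum using (inj₁; inj₂)
open import Function using (_∘_)
open import Relation.Nullary using (yes; no; contradiction)
open import Relation.Binary.PropositionalEquality
  using (_≡_; refl; sym; trans; cong; cong₂; subst; subst₂; module ≡-Reasoning)
open ≡-Reasoning

private
  variable
    n : ℕ

x∈p─q⇒x∉q : ∀ (p q : Subset n) {x} → x ∈ p ─ q → x ∉ q
x∈p─q⇒x∉q (_ ∷ p) (inside ∷ q) {zero} () here
x∈p─q⇒x∉q (_ ∷ p) (_ ∷ q) {suc x} (there x∈p─q) (there x∈q) = x∈p─q⇒x∉q p q x∈p─q x∈q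

y∈move : ∀ (x y : Fin n) e → y ∈ move x y e
y∈move x y e = q⊆p∪q (e - x) ⁅ y ⁆ (x∈⁅x⁆ y)

x∉move : ∀ {x y : Fin n} e → x ≢ y → x ∉ move x y e
x∉move {x = x} {y} e x≢y x∈move with x∈p∪q⁻ (e - x) ⁅ y ⁆ x∈move
... | inj₁ x∈e-x = x∈p─q⇒x∉q e ⁅ x ⁆ x∈e-x (x∈⁅x⁆ x)
... | inj₂ x∈⁅y⁆ = x≢y (x∈⁅y⁆⇒x≡y y x∈⁅y⁆)

∈move⇒∈ : ∀ {x y w : Fin n} e → w ≢ y → w ∈ move x y e → w ∈ e
∈move⇒∈ {x = x} {y} e w≢y w∈move with x∈p∪q⁻ (e - x) ⁅ y ⁆ w∈move
... | inj₁ w∈e-x = p─q⊆p e ⁅ x ⁆ w∈e-x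
... | inj₂ w∈⁅y⁆ = contradiction (x∈⁅y⁆⇒x≡y y w∈⁅y⁆) w≢y

∈⇒∈move : ∀ {x y w : Fin n} e → w ≢ x → w ∈ e → w ∈ move x y e
∈⇒∈move {y = y} e w≢x w∈e = p⊆p∪q ⁅ y ⁆ (x∈p∧x≢y⇒x∈p-y w∈e w≢x)

deg-++ : ∀ (A B : Hypergraph n) w → deg (A ++ B) w ≡ deg A w + deg B w
deg-++ A B w = trans (cong length (filter-++ (w ∈?_) A B)) (length-++ (filter (w ∈?_) A))

deg-middle : ∀ (P S Q : Hypergraph n) w → deg (P ++ S ++ Q) w ≡ deg S w + deg (P ++ Q) w
deg-middle P S Q w = begin
  deg (P ++ S ++ Q) w              ≡⟨ deg-++ P (S ++ Q) w ⟩
  deg P w + deg (S ++ Q) w         ≡⟨ cong (deg P w +_) (deg-++ S Q w) ⟩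
  deg P w + (deg S w + deg Q w)    ≡⟨ sym (+-assoc (deg P w) (deg S w) (deg Q w)) ⟩
  deg P w + deg S w + deg Q w      ≡⟨ cong (_+ deg Q w) (+-comm (deg P w) (deg S w)) ⟩
  deg S w + deg P w + deg Q w      ≡⟨ +-assoc (deg S w) (deg P w) (deg Q w) ⟩
  deg S w + (deg P w + deg Q w)    ≡⟨ cong (deg S w +_) (deg-++ P Q w) ⟨
  deg S w + deg (P ++ Q) w         ∎

deg-all : ∀ (H : Hypergraph n) {w} → All (w ∈_) H → deg H w ≡ length H
deg-all H {w} w∈H = cong length (filter-all (w ∈?_) w∈H)

deg-none : ∀ (H : Hypergraph n) {w} → All (w ∉_) H → deg H w ≡ 0
deg-none H {w} w∉H = cong length (filter-none (w ∈?_) w∉H)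

deg-map : ∀ (f : Subset n → Subset n) (H : Hypergraph n) {w} →
          (∀ e → w ∈ f e → w ∈ e) → (∀ e → w ∈ e → w ∈ f e) →
          deg (map f H) w ≡ deg H w
deg-map f []      to from = refl
deg-map f (e ∷ H) {w} to from with w ∈? e
... | yes w∈e = trans (cong length (filter-accept (w ∈?_) (from e w∈e)))
                      (cong suc (deg-map f H to from))
... | no  w∉e = trans (cong length (filter-reject (w ∈?_) (λ w∈fe → w∉e (to e w∈fe))))
                      (deg-map f H to from)

∑ : (Fin n → ℕ) → ℕ
∑ f = sum (tabulate f)

Zagreb≡∑ : ∀ (H : Hypergraph n) → Zagreb H ≡ ∑ (λ w → deg H w ^ 2)
Zagreb≡∑ H = cong sum (map-tabulate (λ w → w) (λ w → deg H w ^ 2))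

∑-exchange : ∀ (f g : Fin n → ℕ) i → (∀ j → j ≢ i → f j ≡ g j) → ∑ f + g i ≡ ∑ g + f i
∑-exchange {suc n} f g zero f≡g = begin
  f zero + ∑ (f ∘ suc) + g zero  ≡⟨ cong (λ s → f zero + s + g zero) tails ⟩
  f zero + ∑ (g ∘ suc) + g zero  ≡⟨ swap (f zero) (∑ (g ∘ suc)) (g zero) ⟩
  g zero + ∑ (g ∘ suc) + f zero  ∎
  where
  tails : ∑ (f ∘ suc) ≡ ∑ (g ∘ suc)
  tails = cong sum (tabulate-cong (λ j → f≡g (suc j) λ ()))
  swap : ∀ a b c → a + b + c ≡ c + b + a
  swap = solve-∀
∑-exchange {suc n} f g (suc i) f≡g = begin
  f zero + ∑ (f ∘ suc) + g (suc i)    ≡⟨ +-assoc (f zero) _ _ ⟩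
  f zero + (∑ (f ∘ suc) + g (suc i))  ≡⟨ cong₂ _+_ (f≡g zero λ ()) tails ⟩
  g zero + (∑ (g ∘ suc) + f (suc i))  ≡⟨ +-assoc (g zero) _ _ ⟨
  g zero + ∑ (g ∘ suc) + f (suc i)    ∎
  where
  tails : ∑ (f ∘ suc) + g (suc i) ≡ ∑ (g ∘ suc) + f (suc i)
  tails = ∑-exchange (f ∘ suc) (g ∘ suc) i (λ j j≢i → f≡g (suc j) (j≢i ∘ suc-injective))

∑-exchange₂ : ∀ (f g : Fin n → ℕ) {x y} → x ≢ y → (∀ j → j ≢ x → j ≢ y → f j ≡ g j) →
              ∑ f + (g x + g y) ≡ ∑ g + (f x + f y)
∑-exchange₂ f g {x} {y} x≢y f≡g = begin
  ∑ f + (g x + g y)  ≡⟨ cong (λ c → ∑ f + (c + g y)) hx ⟨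
  ∑ f + (h x + g y)  ≡⟨ +-assoc (∑ f) (h x) (g y) ⟨
  ∑ f + h x + g y    ≡⟨ cong (_+ g y) (∑-exchange f h x (λ j j≢x → sym (h-off-x j j≢x))) ⟩
  ∑ h + f x + g y    ≡⟨ +-assoc (∑ h) (f x) (g y) ⟩
  ∑ h + (f x + g y)  ≡⟨ cong (∑ h +_) (+-comm (f x) (g y)) ⟩
  ∑ h + (g y + f x)  ≡⟨ +-assoc (∑ h) (g y) (f x) ⟨
  ∑ h + g y + f x    ≡⟨ cong (_+ f x) (∑-exchange h g y h≡g) ⟩
  ∑ g + h y + f x    ≡⟨ cong (λ c → ∑ g + c + f x) (h-off-x y (x≢y ∘ sym)) ⟩
  ∑ g + f y + f x    ≡⟨ +-assoc (∑ g) (f y) (f x) ⟩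
  ∑ g + (f y + f x)  ≡⟨ cong (∑ g +_) (+-comm (f y) (f x)) ⟩
  ∑ g + (f x + f y)  ∎
  where
  -- h agrees with f away from x and with g away from y
  h : Fin _ → ℕ
  h = updateAt f x (λ _ → g x)
  hx : h x ≡ g x
  hx = updateAt-updates x f
  h-off-x : ∀ j → j ≢ x → h j ≡ f j
  h-off-x j j≢x = updateAt-minimal j x f j≢x
  h≡g : ∀ j → j ≢ y → h j ≡ g j
  h≡g j j≢y with j ≟ᶠ x
  ... | yes refl = hx
  ... | no j≢x   = trans (h-off-x j j≢x) (f≡g j j≢x j≢y)

square-transfer : ∀ {a b r} → 1 ≤ r → r + a ≤ b → (r + a) ^ 2 + b ^ 2 < a ^ 2 + (r + b) ^ 2
square-transfer {a} {b} {suc s} _ r+a≤b with m≤n⇒∃[o]m+o≡n r+a≤b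
... | c , refl = subst ((suc s + a) ^ 2 + (suc s + a + c) ^ 2 <_)
                       (sym (expand a (suc s) c))
                       (m<m+n _ (s≤s z≤n))
  where
  expand : ∀ a r c → a ^ 2 + (r + (r + a + c)) ^ 2 ≡ (r + a) ^ 2 + (r + a + c) ^ 2 + 2 * r * (r + c)
  expand = unfolded
    where
    -- the ring solver rejects _^_, so it is run on the normal form x * (x * 1) of x ^ 2
    unfolded : ∀ a r c → a * (a * 1) + (r + (r + a + c)) * ((r + (r + a + c)) * 1)
                         ≡ (r + a) * ((r + a) * 1) + (r + a + c) * ((r + a + c) * 1) + 2 * r * (r + c)
    unfolded = solve-∀

+-cancel-< : ∀ {m n a b} → m + b ≡ n + a → a < b → m < n
+-cancel-< {m} {n} {a} {b} m+b≡n+a a<b =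
  +-cancelʳ-< a m n (subst (m + a <_) m+b≡n+a (+-monoʳ-< m a<b))

Zagreb-move-< : ∀ (P S Q : Hypergraph n) {x y} → x ≢ y → 1 ≤ length S →
                All (λ e → x ∈ e × y ∉ e) S →
                deg (P ++ S ++ Q) x ≤ deg (P ++ S ++ Q) y →
                Zagreb (P ++ S ++ Q) < Zagreb (P ++ map (move x y) S ++ Q)
Zagreb-move-< P S Q {x} {y} x≢y 1≤r x∈S∌y dx≤dy =
  +-cancel-< exchanged (square-transfer 1≤r (subst₂ _≤_ dx dy dx≤dy))
  where
  H H′ : Hypergraph _
  H  = P ++ S ++ Q
  H′ = P ++ map (move x y) S ++ Q
  r a b : ℕ
  r = length S
  a = deg (P ++ Q) x
  b = deg (P ++ Q) y
  moved : ∀ w → deg (map (move x y) S) w ≡ deg S w → deg H′ w ≡ deg H w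
  moved w eq = trans (deg-middle P _ Q w) (trans (cong (_+ _) eq) (sym (deg-middle P S Q w)))
  dx : deg H x ≡ r + a
  dx = trans (deg-middle P S Q x) (cong (_+ a) (deg-all S (All.map proj₁ x∈S∌y)))
  dy : deg H y ≡ b
  dy = trans (deg-middle P S Q y) (cong (_+ b) (deg-none S (All.map proj₂ x∈S∌y)))
  dx′ : deg H′ x ≡ a
  dx′ = trans (deg-middle P _ Q x)
              (cong (_+ a) (deg-none _ (map⁺ (All.universal (λ e → x∉move e x≢y) S))))
  dy′ : deg H′ y ≡ r + b
  dy′ = trans (deg-middle P _ Q y)
              (cong (_+ b) (trans (deg-all _ (map⁺ (All.universal (y∈move x y) S)))
                                  (length-map (move x y) S)))
  others : ∀ w → w ≢ x → w ≢ y → deg H w ^ 2 ≡ deg H′ w ^ 2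
  others w w≢x w≢y = cong (_^ 2) (sym (moved w
    (deg-map (move x y) S (λ e → ∈move⇒∈ e w≢y) (λ e → ∈⇒∈move e w≢x))))
  exchanged : Zagreb H + (a ^ 2 + (r + b) ^ 2) ≡ Zagreb H′ + ((r + a) ^ 2 + b ^ 2)
  exchanged = begin
    Zagreb H + (a ^ 2 + (r + b) ^ 2)
      ≡⟨ cong₂ _+_ (Zagreb≡∑ H) (cong₂ (λ p q → p ^ 2 + q ^ 2) (sym dx′) (sym dy′)) ⟩
    ∑ (λ w → deg H w ^ 2) + (deg H′ x ^ 2 + deg H′ y ^ 2)
      ≡⟨ ∑-exchange₂ (λ w → deg H w ^ 2) (λ w → deg H′ w ^ 2) x≢y others ⟩
    ∑ (λ w → deg H′ w ^ 2) + (deg H x ^ 2 + deg H y ^ 2)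
      ≡⟨ cong₂ _+_ (sym (Zagreb≡∑ H′)) (cong₂ (λ p q → p ^ 2 + q ^ 2) dx dy) ⟩
    Zagreb H′ + ((r + a) ^ 2 + b ^ 2)  ∎

lemma2p3 : ∀ {n : ℕ} (k : ℕ) (Es Fs R : List (Subset n)) (u v : Fin n) →
    Uniform k (Es ++ Fs ++ R) →
    Unique (Es ++ Fs ++ R) →
    u ≢ v →
    1 ≤ length Es →
    1 ≤ length Fs →
    All (λ e → Pendent (Es ++ Fs ++ R) e × u ∈ e × v ∉ e) Es →
    All (λ e → Pendent (Es ++ Fs ++ R) e × v ∈ e × u ∉ e) Fs →
    (deg (Es ++ Fs ++ R) u ≤ deg (Es ++ Fs ++ R) v →
      Zagreb (Es ++ Fs ++ R) < Zagreb (map (move u v) Es ++ Fs ++ R))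
    × (deg (Es ++ Fs ++ R) v < deg (Es ++ Fs ++ R) u →
      Zagreb (Es ++ Fs ++ R) < Zagreb (Es ++ map (move v u) Fs ++ R))
lemma2p3 k Es Fs R u v _ _ u≢v 1≤r 1≤t onEs onFs =
    Zagreb-move-< [] Es (Fs ++ R) u≢v 1≤r (All.map proj₂ onEs)
  , λ dv<du → Zagreb-move-< Es Fs R (u≢v ∘ sym) 1≤t (All.map proj₂ onFs) (<⇒≤ dv<du)
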